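{- Let $q\ge0$, $t\ge1$ be integers. As an endomorphism of the abelian group $K(\overline{W}(q,t))$, the shift map $\rho$ satisfies $$\rho^2-(1+q+t)\rho+q=0.$$
   Context: $W_k(q,t)$ is the directed multigraph with hub $v_0$ and rim vertices $v_1,\dots,v_k$ (clockwise, indices mod $k$), with $t$ edges each way between $v_0$ and each $v_i$, one edge $v_i\to v_{i-1}$ and $q$ edges $v_i\to v_{i+1}$. Its critical group $K(W_k(q,t))$ (dollar game with bank $v_0$) is the group of critical configurations $[c_1,\dots,c_k]$ under $C_1\oplus C_2=$ the unique critical configuration reachable by legal firings from $C_1+C_2$; it is isomorphic to $\mathbb{Z}^k/\overline{M}_k\mathbb{Z}^k$ where $\overline{M}_1=[t]$, $\overline{M}_2=\begin{pmatrix}1+q+t&-1-q\\-1-q&1+q+t\end{pmatrix}$, and for $k\ge3$ $\overline{M}_k$ has diagonal entries $1+q+t$, entries $(i,i+1\bmod k)=-q$, $(i,i-1\bmod k)=-1$, others $0$. For $k_1\mid k_2$ the map $w\mapsto ww\cdots w$ ($k_2/k_1$ copies) is an injective homomorphism $K(W_{k_1}(q,t))\to K(W_{k_2}(q,t))$; $K(\overline{W}(q,t))$ is the direct limit of the $K(W_k(q,t))$ along these maps, equivalently the group of bi-infinite periodic sequences whose period block is a critical configuration of some $W_k(q,t)$. The shift map $\rho$ shifts sequences left; on $K(W_k(q,t))$ it is $[c_1,\dots,c_k]\mapsto[c_2,\dots,c_k,c_1]$. Integer polynomials in $\rho$ are interpreted using the group operation. -}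

module Defs where

open import Data.Nat as ℕ using (ℕ; zero; suc; _≡ᵇ_)
open import Data.Nat.DivMod using (_mod_)
open import Data.Fin as Fin using (Fin; toℕ)
open import Data.Integer using (ℤ; +_; -_; _+_; _-_; _*_)
open import Data.Bool using (if_then_else_)
open import Data.Product using (∃)
open import Relation.Binary.PropositionalEquality using (_≡_)

-- Configurations on the rim v_1..v_k of W_k(q,t), indexed by Fin k
-- (Fin index i stands for rim vertex v_{i+1}).
Config : ℕ → Set
Config k = Fin k → ℤ

next : ∀ {k} → Fin k → Fin k
next {zero}  ()
next {suc n} i = suc (toℕ i) mod suc n

prev : ∀ {k} → Fin k → Fin k
prev {zero}  ()
prev {suc n} i = (toℕ i ℕ.+ n) mod suc n

ρ : ∀ {k} → Config k → Config k
ρ c i = c (next i)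

Mbar : (q t k : ℕ) → Fin k → Fin k → ℤ
Mbar q t zero ()
Mbar q t 1 i j = + t
Mbar q t 2 i j =
  if toℕ i ≡ᵇ toℕ j then + (1 ℕ.+ q ℕ.+ t) else - (+ (1 ℕ.+ q))
Mbar q t (suc (suc (suc n))) i j =
  if toℕ i ≡ᵇ toℕ j then + (1 ℕ.+ q ℕ.+ t)
  else if toℕ (next i) ≡ᵇ toℕ j then - (+ q)
  else if toℕ (prev i) ≡ᵇ toℕ j then - (+ 1)
  else + 0

Σᶻ : (n : ℕ) → (Fin n → ℤ) → ℤ
Σᶻ zero    f = + 0
Σᶻ (suc n) f = f Fin.zero + Σᶻ n (λ i → f (Fin.suc i))

-- Lattice of principal configurations: integer combinations of the rows
-- of M̄_k (row i = the effect of firing rim vertex v_i).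
InLattice : (q t k : ℕ) → Config k → Set
InLattice q t k x = ∃ λ (z : Config k) → ∀ j → x j ≡ Σᶻ k (λ i → z i * Mbar q t k i j)

-- Equality of classes in K(W_k(q,t)) ≅ ℤ^k / (row lattice of M̄_k)
EqK : (q t k : ℕ) → Config k → Config k → Set
EqK q t k x y = InLattice q t k (λ j → x j - y j)

polyρ : (q t : ℕ) → ∀ {k} → Config k → Config k
polyρ q t x j = ρ (ρ x) j - (+ (1 ℕ.+ q ℕ.+ t)) * ρ x j + (+ q) * x j

-- Elements of K(W̄(q,t)) (direct limit): an element of some K(W_k), k ≥ 1.
-- Zero test in K(W̄): since the connecting maps are injective homomorphisms,
-- (k , x) is zero in the limit iff x is zero in K(W_k).
IsZeroK : (q t k : ℕ) → Config k → Set
IsZeroK q t k x = EqK q t k x (λ _ → + 0)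

-- Firing every rim vertex v_i with multiplicity −c_{i+1} changes a configuration c
-- by exactly (ρ² − (1+q+t)ρ + q) c: column j of M̄_k meets only the rows j−1, j, j+1,
-- with entries −q, 1+q+t, −1.  So this polynomial in ρ is zero on every K(W_k(q,t)),
-- hence on their direct limit.
module Submission where

open import Defs
open import Data.Nat as ℕ using (ℕ; zero; suc; _≤_; _<_; _≡ᵇ_; NonZero)
import Data.Nat.Properties as ℕ
open import Data.Nat.DivMod using (_%_; m≡m%n+[m/n]*n; m%n%n≡m%n; %-distribˡ-+; [m+n]%n≡m%n; m<n⇒m%n≡m)
open import Data.Nat.Divisibility using (divides; >⇒∤)
open import Data.Fin using (Fin; toℕ; _≟_)
import Data.Fin.Properties as Finₚ
open import Data.Integer using (ℤ; +_; -_; _+_; _-_; _*_)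
import Data.Integer.Properties as ℤ
open import Data.Integer.Tactic.RingSolver using (solve-∀)
open import Data.Vec.Functional using (updateAt)
open import Data.Vec.Functional.Properties using (updateAt-updates; updateAt-minimal)
open import Algebra.Properties.CommutativeSemigroup ℤ.+-commutativeSemigroup using (x∙yz≈y∙xz)
open import Data.Bool using (true; false)
open import Data.Product using (_,_)
open import Function using (_∘_; const)
open import Relation.Nullary using (contradiction; yes; no)
open import Relation.Binary.PropositionalEquality

≡ᵇ-refl : ∀ n → (n ≡ᵇ n) ≡ true
≡ᵇ-refl zero    = refl
≡ᵇ-refl (suc n) = ≡ᵇ-refl n

≢⇒≡ᵇ≡false : ∀ m n → m ≢ n → (m ≡ᵇ n) ≡ false
≢⇒≡ᵇ≡false zero    zero    m≢n = contradiction refl m≢n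
≢⇒≡ᵇ≡false zero    (suc n) _   = refl
≢⇒≡ᵇ≡false (suc m) zero    _   = refl
≢⇒≡ᵇ≡false (suc m) (suc n) m≢n = ≢⇒≡ᵇ≡false m n (m≢n ∘ cong suc)

toℕ-≢⇒≡ᵇ≡false : ∀ {k} {i j : Fin k} → i ≢ j → (toℕ i ≡ᵇ toℕ j) ≡ false
toℕ-≢⇒≡ᵇ≡false i≢j = ≢⇒≡ᵇ≡false _ _ (i≢j ∘ Finₚ.toℕ-injective)

[m+n%d]%d≡[m+n]%d : ∀ m n d .{{_ : NonZero d}} → (m ℕ.+ n % d) % d ≡ (m ℕ.+ n) % d
[m+n%d]%d≡[m+n]%d m n d = begin
  (m ℕ.+ n % d) % d           ≡⟨ %-distribˡ-+ m (n % d) d ⟩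
  (m % d ℕ.+ n % d % d) % d   ≡⟨ cong (λ r → (m % d ℕ.+ r) % d) (m%n%n≡m%n n d) ⟩
  (m % d ℕ.+ n % d) % d       ≡⟨ %-distribˡ-+ m n d ⟨
  (m ℕ.+ n) % d               ∎
  where open ≡-Reasoning

[1+d+m]%n≢m : ∀ d m n .{{_ : NonZero n}} → suc d < n → (suc d ℕ.+ m) % n ≢ m
[1+d+m]%n≢m d m n 1+d<n eq = >⇒∤ 1+d<n (divides ((suc d ℕ.+ m) ℕ./ n) (ℕ.+-cancelʳ-≡ m _ _ (begin
  suc d ℕ.+ m                                          ≡⟨ m≡m%n+[m/n]*n (suc d ℕ.+ m) n ⟩
  (suc d ℕ.+ m) % n ℕ.+ (suc d ℕ.+ m) ℕ./ n ℕ.* n     ≡⟨ cong (ℕ._+ (suc d ℕ.+ m) ℕ./ n ℕ.* n) eq ⟩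
  m ℕ.+ (suc d ℕ.+ m) ℕ./ n ℕ.* n                      ≡⟨ ℕ.+-comm m _ ⟩
  (suc d ℕ.+ m) ℕ./ n ℕ.* n ℕ.+ m                      ∎)))
  where open ≡-Reasoning

module CyclicIndex (n : ℕ) where

  private
    N : ℕ
    N = suc n

  toℕ-next : (i : Fin N) → toℕ (next i) ≡ (1 ℕ.+ toℕ i) % N
  toℕ-next i = Finₚ.toℕ-fromℕ< _

  toℕ-prev : (i : Fin N) → toℕ (prev i) ≡ (n ℕ.+ toℕ i) % N
  toℕ-prev i = trans (Finₚ.toℕ-fromℕ< _) (cong (_% N) (ℕ.+-comm (toℕ i) n))

  toℕ-next² : (i : Fin N) → toℕ (next (next i)) ≡ (2 ℕ.+ toℕ i) % N
  toℕ-next² i = trans (toℕ-next (next i))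
    (trans (cong (λ r → (1 ℕ.+ r) % N) (toℕ-next i)) ([m+n%d]%d≡[m+n]%d 1 (1 ℕ.+ toℕ i) N))

  private
    [N+i]%N≡i : (i : Fin N) → (N ℕ.+ toℕ i) % N ≡ toℕ i
    [N+i]%N≡i i = begin
      (N ℕ.+ toℕ i) % N   ≡⟨ cong (_% N) (ℕ.+-comm N (toℕ i)) ⟩
      (toℕ i ℕ.+ N) % N   ≡⟨ [m+n]%n≡m%n (toℕ i) N ⟩
      toℕ i % N           ≡⟨ m<n⇒m%n≡m (Finₚ.toℕ<n i) ⟩
      toℕ i               ∎
      where open ≡-Reasoning

  next-prev : (i : Fin N) → next (prev i) ≡ i
  next-prev i = Finₚ.toℕ-injective (begin
    toℕ (next (prev i))              ≡⟨ toℕ-next (prev i) ⟩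
    (1 ℕ.+ toℕ (prev i)) % N         ≡⟨ cong (λ r → (1 ℕ.+ r) % N) (toℕ-prev i) ⟩
    (1 ℕ.+ (n ℕ.+ toℕ i) % N) % N    ≡⟨ [m+n%d]%d≡[m+n]%d 1 (n ℕ.+ toℕ i) N ⟩
    (N ℕ.+ toℕ i) % N                ≡⟨ [N+i]%N≡i i ⟩
    toℕ i                            ∎)
    where open ≡-Reasoning

  prev-next : (i : Fin N) → prev (next i) ≡ i
  prev-next i = Finₚ.toℕ-injective (begin
    toℕ (prev (next i))              ≡⟨ toℕ-prev (next i) ⟩
    (n ℕ.+ toℕ (next i)) % N         ≡⟨ cong (λ r → (n ℕ.+ r) % N) (toℕ-next i) ⟩
    (n ℕ.+ (1 ℕ.+ toℕ i) % N) % N    ≡⟨ [m+n%d]%d≡[m+n]%d n (1 ℕ.+ toℕ i) N ⟩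
    (n ℕ.+ (1 ℕ.+ toℕ i)) % N        ≡⟨ cong (_% N) (ℕ.+-suc n (toℕ i)) ⟩
    (N ℕ.+ toℕ i) % N                ≡⟨ [N+i]%N≡i i ⟩
    toℕ i                            ∎)
    where open ≡-Reasoning

  next≢id : 1 < N → (i : Fin N) → next i ≢ i
  next≢id 1<N i eq = [1+d+m]%n≢m 0 (toℕ i) N 1<N (trans (sym (toℕ-next i)) (cong toℕ eq))

  next²≢id : 2 < N → (i : Fin N) → next (next i) ≢ i
  next²≢id 2<N i eq = [1+d+m]%n≢m 1 (toℕ i) N 2<N (trans (sym (toℕ-next² i)) (cong toℕ eq))

  prev≢id : 1 < N → (i : Fin N) → prev i ≢ i
  prev≢id 1<N i eq = next≢id 1<N i (trans (sym (cong next eq)) (next-prev i))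

  next≢prev : 2 < N → (i : Fin N) → next i ≢ prev i
  next≢prev 2<N i eq = next²≢id 2<N i (trans (cong next eq) (next-prev i))

Σᶻ-cong : ∀ n {f g : Fin n → ℤ} → (∀ i → f i ≡ g i) → Σᶻ n f ≡ Σᶻ n g
Σᶻ-cong zero    f≗g = refl
Σᶻ-cong (suc n) f≗g = cong₂ _+_ (f≗g Fin.zero) (Σᶻ-cong n (f≗g ∘ Fin.suc))

Σᶻ-zero : ∀ n → Σᶻ n (const (+ 0)) ≡ + 0
Σᶻ-zero zero    = refl
Σᶻ-zero (suc n) = trans (ℤ.+-identityˡ _) (Σᶻ-zero n)

clear : ∀ {n} → (Fin n → ℤ) → Fin n → Fin n → ℤ
clear f a = updateAt f a (const (+ 0))

Σᶻ-clear : ∀ {n} (f : Fin n → ℤ) (a : Fin n) → Σᶻ n f ≡ f a + Σᶻ n (clear f a)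
Σᶻ-clear f Fin.zero    = cong (λ s → f Fin.zero + s) (sym (ℤ.+-identityˡ _))
Σᶻ-clear f (Fin.suc a) = trans (cong (λ s → f Fin.zero + s) (Σᶻ-clear (f ∘ Fin.suc) a))
                               (x∙yz≈y∙xz (f Fin.zero) (f (Fin.suc a)) _)

Σᶻ-three-points : ∀ n (f : Fin n → ℤ) (a b c : Fin n) → b ≢ a → c ≢ a → c ≢ b →
                  (∀ i → i ≢ a → i ≢ b → i ≢ c → f i ≡ + 0) →
                  Σᶻ n f ≡ f a + (f b + f c)
Σᶻ-three-points n f a b c b≢a c≢a c≢b vanishes = begin
  Σᶻ n f                                 ≡⟨ Σᶻ-clear f a ⟩
  f a + Σᶻ n fa                          ≡⟨ cong (λ s → f a + s) (Σᶻ-clear fa b) ⟩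
  f a + (fa b + Σᶻ n fab)                ≡⟨ cong (λ s → f a + (fa b + s)) (Σᶻ-clear fab c) ⟩
  f a + (fa b + (fab c + Σᶻ n fabc))     ≡⟨ cong (λ s → f a + (fa b + (fab c + s))) Σfabc≡0 ⟩
  f a + (fa b + (fab c + + 0))           ≡⟨ cong (λ s → f a + (fa b + s)) (ℤ.+-identityʳ _) ⟩
  f a + (fa b + fab c)                   ≡⟨ cong₂ (λ u v → f a + (u + v)) fa-b fab-c ⟩
  f a + (f b + f c)                      ∎
  where
  open ≡-Reasoning
  fa fab fabc : Fin n → ℤ
  fa   = clear f a
  fab  = clear fa b
  fabc = clear fab c

  fa-b : fa b ≡ f b
  fa-b = updateAt-minimal b a f b≢a

  fab-c : fab c ≡ f c
  fab-c = trans (updateAt-minimal c b fa c≢b) (updateAt-minimal c a f c≢a)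

  fabc≡0 : ∀ i → fabc i ≡ + 0
  fabc≡0 i with i ≟ c | i ≟ b | i ≟ a
  ... | yes refl | _ | _ = updateAt-updates c fab
  ... | no i≢c | yes refl | _ = trans (updateAt-minimal i c fab i≢c) (updateAt-updates b fa)
  ... | no i≢c | no i≢b | yes refl =
    trans (updateAt-minimal i c fab i≢c) (trans (updateAt-minimal i b fa i≢b) (updateAt-updates a f))
  ... | no i≢c | no i≢b | no i≢a =
    trans (updateAt-minimal i c fab i≢c)
      (trans (updateAt-minimal i b fa i≢b) (trans (updateAt-minimal i a f i≢a) (vanishes i i≢a i≢b i≢c)))

  Σfabc≡0 : Σᶻ n fabc ≡ + 0
  Σfabc≡0 = trans (Σᶻ-cong n fabc≡0) (Σᶻ-zero n)

module Wheel (q t : ℕ) where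

  diagonal : ℤ
  diagonal = + (1 ℕ.+ q ℕ.+ t)

  fire : ∀ k → Config k → Config k
  fire k z j = Σᶻ k (λ i → z i * Mbar q t k i j)

  module Rim (n : ℕ) where
    open CyclicIndex (suc (suc n))

    private
      k : ℕ
      k = suc (suc (suc n))

      1<k : 1 < k
      1<k = ℕ.s≤s (ℕ.s≤s ℕ.z≤n)

      2<k : 2 < k
      2<k = ℕ.s≤s (ℕ.s≤s (ℕ.s≤s ℕ.z≤n))

    Mbar-diag : (j : Fin k) → Mbar q t k j j ≡ diagonal
    Mbar-diag j rewrite ≡ᵇ-refl (toℕ j) = refl

    Mbar-prev : (j : Fin k) → Mbar q t k (prev j) j ≡ - (+ q)
    Mbar-prev j rewrite toℕ-≢⇒≡ᵇ≡false (prev≢id 1<k j) | next-prev j | ≡ᵇ-refl (toℕ j) = refl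

    Mbar-next : (j : Fin k) → Mbar q t k (next j) j ≡ - (+ 1)
    Mbar-next j rewrite toℕ-≢⇒≡ᵇ≡false (next≢id 1<k j) | toℕ-≢⇒≡ᵇ≡false (next²≢id 2<k j)
                      | prev-next j | ≡ᵇ-refl (toℕ j) = refl

    Mbar-far : (i j : Fin k) → i ≢ j → i ≢ prev j → i ≢ next j → Mbar q t k i j ≡ + 0
    Mbar-far i j i≢j i≢prev i≢next
      rewrite toℕ-≢⇒≡ᵇ≡false i≢j
            | toℕ-≢⇒≡ᵇ≡false {i = next i} {j} (λ e → i≢prev (trans (sym (prev-next i)) (cong prev e)))
            | toℕ-≢⇒≡ᵇ≡false {i = prev i} {j} (λ e → i≢next (trans (sym (next-prev i)) (cong next e))) = refl

    fire-−ρ≡polyρ : (x : Config k) (j : Fin k) → fire k (λ i → - ρ x i) j ≡ polyρ q t x j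
    fire-−ρ≡polyρ x j = begin
      fire k z j                                     ≡⟨ Σᶻ-three-points k f j (prev j) (next j)
                                                          (prev≢id 1<k j) (next≢id 1<k j) (next≢prev 2<k j) f-far ⟩
      f j + (f (prev j) + f (next j))                ≡⟨ cong₂ _+_ f-diag (cong₂ _+_ f-prev f-next) ⟩
      z j * diagonal + (- x j * - (+ q) + - x (next (next j)) * - (+ 1))
                                                     ≡⟨ identity (x (next (next j))) (x (next j)) (x j) diagonal (+ q) ⟩
      polyρ q t x j                                  ∎
      where
      open ≡-Reasoning
      z : Config k
      z i = - ρ x i
      f : Fin k → ℤ
      f i = z i * Mbar q t k i j

      f-far : ∀ i → i ≢ j → i ≢ prev j → i ≢ next j → f i ≡ + 0
      f-far i i≢j i≢prev i≢next = trans (cong (z i *_) (Mbar-far i j i≢j i≢prev i≢next)) (ℤ.*-zeroʳ (z i))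

      f-diag : f j ≡ z j * diagonal
      f-diag = cong (z j *_) (Mbar-diag j)

      f-prev : f (prev j) ≡ - x j * - (+ q)
      f-prev = cong₂ (λ w m → - x w * m) (next-prev j) (Mbar-prev j)

      f-next : f (next j) ≡ - x (next (next j)) * - (+ 1)
      f-next = cong (z (next j) *_) (Mbar-next j)

      identity : ∀ a b c C Q → - b * C + (- c * - Q + - a * - (+ 1)) ≡ a - C * b + Q * c
      identity = solve-∀

  fire-−ρ≡polyρ : ∀ k (x : Config k) (j : Fin k) → fire k (λ i → - ρ x i) j ≡ polyρ q t x j
  fire-−ρ≡polyρ zero x ()
  fire-−ρ≡polyρ 1 x Fin.zero = loop (x Fin.zero) (+ q) (+ t)
    where
    loop : ∀ a Q T → - a * T + + 0 ≡ a - (+ 1 + Q + T) * a + Q * a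
    loop = solve-∀
  fire-−ρ≡polyρ 2 x Fin.zero = digon (x Fin.zero) (x (Fin.suc Fin.zero)) diagonal (+ q)
    where
    digon : ∀ a b C Q → - b * C + (- a * - (+ 1 + Q) + + 0) ≡ a - C * b + Q * a
    digon = solve-∀
  fire-−ρ≡polyρ 2 x (Fin.suc Fin.zero) = digon (x (Fin.suc Fin.zero)) (x Fin.zero) diagonal (+ q)
    where
    digon : ∀ a b C Q → - a * - (+ 1 + Q) + (- b * C + + 0) ≡ a - C * b + Q * a
    digon = solve-∀
  fire-−ρ≡polyρ (suc (suc (suc n))) = Rim.fire-−ρ≡polyρ n

theorem9 : (q t : ℕ) → 1 ≤ t → (k : ℕ) → 1 ≤ k → (x : Config k) →
           IsZeroK q t k (polyρ q t x)
theorem9 q t _ k _ x = (λ i → - ρ x i) , λ j → trans (ℤ.+-identityʳ _) (sym (fire-−ρ≡polyρ k x j))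
  where open Wheel q t
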